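{- Let $\mathcal{G}$ be a cofinitary group, $(s,E)\in\mathbb{Z}_\mathcal{G}$ and $n\in\omega\setminus\bigcup\mathcal{O}^c_s$. Then there is $K<\omega$ such that for every $k>K$ there is $(t,E)\in\mathbb{Z}_\mathcal{G}$ with $(t,E)\le(s,E)$, $O_t(n)\in\mathcal{O}^c_t$ and $|O_t(n)|=k$.
   Context: A cofinitary group is a subgroup $\mathcal{G}$ of the group $S_\infty$ of permutations of $\omega$ in which every non-identity element has only finitely many fixed points. Words: $W_\mathcal{G}$ is the set of words in the alphabet $\mathcal{G}\cup\{x,x^{ -1}\}$. For a (partial) injection $s$ and $w\in W_\mathcal{G}$, $w[s]$ is obtained by replacing $x,x^{ -1}$ by $s,s^{ -1}$ and composing (rightmost letter first); $\mathrm{fix}(w[s])=\{n: w[s](n)\text{ defined and }=n\}$. A word is nice if it is $x^k$ ($k>0$) or $g_lx^{k_l}\cdots g_1x^{k_1}g_0x^{k_0}$ with $k_0>0$, $k_i\in\mathbb{Z}\setminus\{0\}$, $g_i\in\mathcal{G}\setminus\{\mathrm{id}\}$; $W^*_\mathcal{G}$ is the set of nice words. $\mathbb{Z}_\mathcal{G}$ consists of pairs $(s,E)$, $s$ a finite partial injection $\omega\to\omega$, $E$ a finite subset of $W^*_\mathcal{G}$, with $(t,F)\le(s,E)$ iff $s\subseteq t$, $E\subseteq F$ and $\mathrm{fix}(w[t])=\mathrm{fix}(w[s])$ for all $w\in E$. Orbits: for a finite partial injection $s$ and $n<\omega$, $O_s(n)$ is the smallest set containing $n$ closed under applying $s$ and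 $s^{ -1}$; $\mathcal{O}_s=\{O_s(n):n<\omega\}$; $O\in\mathcal{O}_s$ is closed if $O\subseteq\mathrm{dom}(s)\cap\mathrm{ran}(s)$, and $\mathcal{O}^c_s$ is the set of closed orbits of $s$. -}

module Defs where

open import Data.Nat using (ℕ; zero; suc; _<_)
open import Data.Integer as ℤ using (ℤ; +_; -[1+_])
open import Data.List using (List; []; _∷_; _++_; map; replicate; concatMap; length)
open import Data.List.Membership.Propositional using (_∈_)
open import Data.List.Relation.Unary.Unique.Propositional using (Unique)
open import Data.Product using (Σ; ∃; _×_; _,_; proj₁; proj₂)
open import Function.Definitions using (Bijective)
open import Function.Bundles using (_⇔_)
open import Relation.Binary.PropositionalEquality using (_≡_; _≢_)
open import Relation.Nullary using (¬_)

IsId : (ℕ → ℕ) → Set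
IsId f = ∀ n → f n ≡ n

FinitePred : (ℕ → Set) → Set
FinitePred P = Σ (List ℕ) λ xs → ∀ n → P n → n ∈ xs

record CofinitaryGroup : Set₁ where
  field
    member     : (ℕ → ℕ) → Set
    member-ext : ∀ {f g} → member f → (∀ n → f n ≡ g n) → member g
    member-bij : ∀ {f} → member f → Bijective _≡_ _≡_ f
    id-mem     : member (λ n → n)
    comp-mem   : ∀ {f g} → member f → member g → member (λ n → f (g n))
    inv-mem    : ∀ {f} → member f →
                 Σ (ℕ → ℕ) λ g → member g × (∀ n → g (f n) ≡ n) × (∀ n → f (g n) ≡ n)
    cofinitary : ∀ {f} → member f → ¬ IsId f → FinitePred (λ n → f n ≡ n)

open CofinitaryGroup public

record FPInj : Set where
  constructor mkFPInj
  field
    graph  : List (ℕ × ℕ)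
    injDom : Unique (map proj₁ graph)   -- functional
    injRan : Unique (map proj₂ graph)

open FPInj public

_↦[_]_ : ℕ → FPInj → ℕ → Set
a ↦[ s ] b = (a , b) ∈ graph s

_⊑_ : FPInj → FPInj → Set
s ⊑ t = ∀ {a b} → a ↦[ s ] b → a ↦[ t ] b

InDom InRan : FPInj → ℕ → Set
InDom s a = ∃ λ b → a ↦[ s ] b
InRan s a = ∃ λ b → b ↦[ s ] a

data Letter : Set where
  gl : (ℕ → ℕ) → Letter
  xl : Letter
  xi : Letter

-- a word l_m ⋯ l_1 is the list (l_m ∷ ⋯ ∷ l_1 ∷ [])
Word : Set
Word = List Letter

Step : FPInj → Letter → ℕ → ℕ → Set
Step s (gl f) a b = f a ≡ b
Step s xl     a b = a ↦[ s ] b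
Step s xi     a b = b ↦[ s ] a

-- w[s](a) is defined and equals b  (rightmost letter applied first)
Eval : FPInj → Word → ℕ → ℕ → Set
Eval s []      a c = a ≡ c
Eval s (l ∷ w) a c = Σ ℕ λ b → Eval s w a b × Step s l b c

Fix : FPInj → Word → ℕ → Set
Fix s w n = Eval s w n n

xpow : ℤ → Word
xpow (+ k)      = replicate k xl
xpow -[1+ k ]   = replicate (suc k) xi

record Block (G : CofinitaryGroup) : Set where
  constructor block
  field
    g     : ℕ → ℕ
    g∈G   : member G g
    g≠id  : ¬ IsId g
    k     : ℤ
    k≠0   : k ≢ + 0

data NiceWord (G : CofinitaryGroup) : Set where
  powX  : (k : ℕ) → 0 < k → NiceWord G
  -- blocks = [ (g_l,k_l) , … , (g_1,k_1) ] followed by g_0 x^{k_0}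
  gWord : (blocks : List (Block G)) →
          (g₀ : ℕ → ℕ) → member G g₀ → ¬ IsId g₀ →
          (k₀ : ℕ) → 0 < k₀ → NiceWord G

toWord : ∀ {G} → NiceWord G → Word
toWord (powX k _) = replicate k xl
toWord (gWord bs g₀ _ _ k₀ _) =
  concatMap (λ b → gl (Block.g b) ∷ xpow (Block.k b)) bs ++ (gl g₀ ∷ replicate k₀ xl)

_,_≤ℤ_,_ : ∀ {G} → FPInj → List (NiceWord G) → FPInj → List (NiceWord G) → Set
t , F ≤ℤ s , E =
  (s ⊑ t) × (∀ {w} → w ∈ E → w ∈ F) ×
  (∀ {w} → w ∈ E → ∀ n → Fix t (toWord w) n ⇔ Fix s (toWord w) n)

data Orb (s : FPInj) (n : ℕ) : ℕ → Set where
  here : Orb s n n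
  fwd  : ∀ {a b} → Orb s n a → a ↦[ s ] b → Orb s n b
  bwd  : ∀ {a b} → Orb s n a → b ↦[ s ] a → Orb s n b

Closed : FPInj → ℕ → Set
Closed s n = ∀ m → Orb s n m → InDom s m × InRan s m

InClosedOrbit : FPInj → ℕ → Set
InClosedOrbit s n = ∃ λ m → Closed s m × Orb s m n

HasCard : (ℕ → Set) → ℕ → Set
HasCard P k = Σ (List ℕ) λ xs → Unique xs × length xs ≡ k × (∀ m → m ∈ xs ⇔ P m)

-- Since s is a finite partial injection and n lies on no closed orbit, O_s(n) is a path
-- a₀ → ⋯ → aⱼ with no predecessor of a₀ and no successor of aⱼ.  Closing it up through
-- m fresh points aⱼ → b₀ → ⋯ → b_{m-1} → a₀ yields a closed orbit of size |O_s(n)| + m.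
-- The bᵢ are chosen one after another so large that no group element g occurring in E
-- relates them to old points or to each other, and m is taken larger than every exponent
-- in E.  Then in a fixed-point computation of a nice word every letter g is applied to an
-- old point and yields an old point, and a block x^k with |k| ≤ m joining two old points
-- cannot pass through the m + 1 new edges; hence no new fixed points arise.

module Submission where

open import Defs
open import Data.Empty using (⊥-elim)
open import Data.Integer using (+_; -[1+_]; ∣_∣)
open import Data.List using (List; []; _∷_; _++_; map; length; replicate; concatMap; applyUpTo)
open import Data.List.Extrema.Nat using (max; xs≤max)
open import Data.List.Membership.Propositional using (_∈_; _∉_; _─_; find; lose)
open import Data.List.Membership.Propositional.Properties
  using (∈-map⁺; ∈-map⁻; ∈-++⁺ˡ; ∈-++⁺ʳ; ∈-++⁻; ∈-concat⁺′; ∈-applyUpTo⁺; ∈-applyUpTo⁻)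
open import Data.List.Properties using (map-++; map-applyUpTo; length-++; length-applyUpTo; length-removeAt′)
open import Data.List.Relation.Binary.Subset.Propositional using (_⊆_)
open import Data.List.Relation.Unary.All as All using (All; []; _∷_)
open import Data.List.Relation.Unary.All.Properties using (¬Any⇒All¬; applyUpTo⁺₁)
open import Data.List.Relation.Unary.AllPairs using ([]; _∷_)
open import Data.List.Relation.Unary.Any as Any using (Any; here; there; index)
open import Data.List.Relation.Unary.Unique.Propositional using (Unique)
import Data.List.Relation.Unary.Unique.Propositional.Properties as Unique
open import Data.Nat using (ℕ; zero; suc; _<_; _≤_; _+_; z≤n; s≤s; s≤s⁻¹; z<s; s<s; _≟_)
open import Data.Nat.Properties
open import Data.Product using (Σ; ∃; _×_; _,_; proj₁; proj₂)
open import Data.Sum using (_⊎_; inj₁; inj₂)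
open import Function using (_∘_; flip)
open import Function.Bundles using (mk⇔)
open import Relation.Binary.Definitions using (tri<; tri≈; tri>)
open import Relation.Binary.PropositionalEquality
open import Relation.Nullary using (¬_; Dec; yes; no; map′)

map-unique⇒injective : ∀ {A B : Set} (f : A → B) {xs : List A} → Unique (map f xs) →
                       ∀ {x y} → x ∈ xs → y ∈ xs → f x ≡ f y → x ≡ y
map-unique⇒injective f (_ ∷ _)   (here refl) (here refl) _  = refl
map-unique⇒injective f (fx∉ ∷ _) (here refl) (there y∈)  eq =
  ⊥-elim (All.lookup fx∉ (∈-map⁺ f y∈) eq)
map-unique⇒injective f (fy∉ ∷ _) (there x∈)  (here refl) eq =
  ⊥-elim (All.lookup fy∉ (∈-map⁺ f x∈) (sym eq))
map-unique⇒injective f (_ ∷ unique) (there x∈) (there y∈) eq =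
  map-unique⇒injective f unique x∈ y∈ eq

∈-concatMap⁺′ : ∀ {A B : Set} (f : A → List B) {x xs y} →
                y ∈ f x → x ∈ xs → y ∈ concatMap f xs
∈-concatMap⁺′ f y∈ x∈ = ∈-concat⁺′ y∈ (∈-map⁺ f x∈)

∈-─⁺ : ∀ {A : Set} {x y : A} {xs} (x∈ : x ∈ xs) → y ∈ xs → y ≢ x → y ∈ xs ─ x∈
∈-─⁺ (here refl) (here refl) y≢x = ⊥-elim (y≢x refl)
∈-─⁺ (here refl) (there y∈)  _   = y∈
∈-─⁺ (there x∈)  (here refl) _   = here refl
∈-─⁺ (there x∈)  (there y∈)  y≢x = there (∈-─⁺ x∈ y∈ y≢x)

Unique-⊆⇒length≤ : ∀ {A : Set} {xs ys : List A} → Unique xs → xs ⊆ ys → length xs ≤ length ys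
Unique-⊆⇒length≤ {xs = []}     _             _     = z≤n
Unique-⊆⇒length≤ {xs = x ∷ xs} {ys} (x∉xs ∷ unique) xs⊆ys =
  ≤-trans (s≤s (Unique-⊆⇒length≤ unique xs⊆ys─x))
          (≤-reflexive (sym (length-removeAt′ ys (index x∈ys))))
  where
  x∈ys : x ∈ ys
  x∈ys = xs⊆ys (here refl)
  xs⊆ys─x : xs ⊆ ys ─ x∈ys
  xs⊆ys─x z∈ = ∈-─⁺ x∈ys (xs⊆ys (there z∈)) (λ z≡x → All.lookup x∉xs z∈ (sym z≡x))

Functional Injective : (ℕ → ℕ → Set) → Set
Functional R = ∀ {a b b′} → R a b → R a b′ → b ≡ b′
Injective  R = ∀ {a a′ b} → R a b → R a′ b → a ≡ a′

module _ (s : FPInj) where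

  ↦-functional : Functional (_↦[ s ]_)
  ↦-functional ab ab′ = cong proj₂ (map-unique⇒injective proj₁ (injDom s) ab ab′ refl)

  ↦-injective : Injective (_↦[ s ]_)
  ↦-injective ab a′b = cong proj₁ (map-unique⇒injective proj₂ (injRan s) ab a′b refl)

  inDom? : ∀ a → Dec (InDom s a)
  inDom? a = map′ witness (λ (_ , ab) → lose ab refl) (Any.any? (λ e → proj₁ e ≟ a) (graph s))
    where
    witness : Any (λ e → proj₁ e ≡ a) (graph s) → InDom s a
    witness e with find e
    ... | (_ , b) , ab , refl = b , ab

  inRan? : ∀ b → Dec (InRan s b)
  inRan? b = map′ witness (λ (_ , ab) → lose ab refl) (Any.any? (λ e → proj₂ e ≟ b) (graph s))
    where
    witness : Any (λ e → proj₂ e ≡ b) (graph s) → InRan s b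
    witness e with find e
    ... | (a , _) , ab , refl = a , ab

  points : List ℕ
  points = map proj₁ (graph s) ++ map proj₂ (graph s)

  dom∈points : ∀ {a b} → a ↦[ s ] b → a ∈ points
  dom∈points ab = ∈-++⁺ˡ (∈-map⁺ proj₁ ab)

  ran∈points : ∀ {a b} → a ↦[ s ] b → b ∈ points
  ran∈points ab = ∈-++⁺ʳ (map proj₁ (graph s)) (∈-map⁺ proj₂ ab)

InField : FPInj → ℕ → Set
InField s x = InDom s x ⊎ InRan s x

Orb-least : ∀ {s n} (P : ℕ → Set) → P n →
            (∀ {a b} → P a → a ↦[ s ] b → P b) → (∀ {a b} → P a → b ↦[ s ] a → P b) →
            ∀ {m} → Orb s n m → P m
Orb-least P Pn fwd-P bwd-P here        = Pn
Orb-least P Pn fwd-P bwd-P (fwd o ab)  = fwd-P (Orb-least P Pn fwd-P bwd-P o) ab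
Orb-least P Pn fwd-P bwd-P (bwd o ba)  = bwd-P (Orb-least P Pn fwd-P bwd-P o) ba

Orb-mono : ∀ {s t n m} → s ⊑ t → Orb s n m → Orb t n m
Orb-mono s⊑t here       = here
Orb-mono s⊑t (fwd o ab) = fwd (Orb-mono s⊑t o) (s⊑t ab)
Orb-mono s⊑t (bwd o ba) = bwd (Orb-mono s⊑t o) (s⊑t ba)

Eval-mono : ∀ {s t} → s ⊑ t → ∀ w {a c} → Eval s w a c → Eval t w a c
Eval-mono s⊑t []          run              = run
Eval-mono s⊑t (gl f ∷ w)  (b , run , step) = b , Eval-mono s⊑t w run , step
Eval-mono s⊑t (xl ∷ w)    (b , run , step) = b , Eval-mono s⊑t w run , s⊑t step
Eval-mono s⊑t (xi ∷ w)    (b , run , step) = b , Eval-mono s⊑t w run , s⊑t step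

Eval-++⁻ : ∀ {s} u {v a c} → Eval s (u ++ v) a c → ∃ λ b → Eval s v a b × Eval s u b c
Eval-++⁻ []      run              = _ , run , refl
Eval-++⁻ (l ∷ u) (b , run , step) with Eval-++⁻ u run
... | mid , run-v , run-u = mid , run-v , (b , run-u , step)

Eval-++⁺ : ∀ {s} u {v a b c} → Eval s v a b → Eval s u b c → Eval s (u ++ v) a c
Eval-++⁺ []      run-v refl                 = run-v
Eval-++⁺ (l ∷ u) run-v (b , run-u , step)   = b , Eval-++⁺ u run-v run-u , step

x-run-ends : ∀ {s} r {a c} → Eval s (replicate (suc r) xl) a c → InDom s a × InRan s c
x-run-ends zero    (_ , refl , ac) = (_ , ac) , (_ , ac)
x-run-ends (suc r) (_ , run , bc)  = proj₁ (x-run-ends r run) , (_ , bc)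

x⁻-run-ends : ∀ {s} r {a c} → Eval s (replicate (suc r) xi) a c → InRan s a × InDom s c
x⁻-run-ends zero    (_ , refl , ca) = (_ , ca) , (_ , ca)
x⁻-run-ends (suc r) (_ , run , cb)  = proj₁ (x⁻-run-ends r run) , (_ , cb)

xpow-ends : ∀ {s} k {a c} → k ≢ + 0 → Eval s (xpow k) a c → InField s a × InField s c
xpow-ends (+ zero)   k≢0 _   = ⊥-elim (k≢0 refl)
xpow-ends (+ suc r)  _   run = let (a∈ , c∈) = x-run-ends r run in inj₁ a∈ , inj₂ c∈
xpow-ends -[1+ r ]   _   run = let (a∈ , c∈) = x⁻-run-ends r run in inj₂ a∈ , inj₁ c∈

record Path (R : ℕ → ℕ → Set) (P : ℕ → Set) (first last : ℕ) (xs : List ℕ) : Set where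
  field
    unique          : Unique xs
    first∈          : first ∈ xs
    last∈           : last ∈ xs
    all-P           : ∀ {x} → x ∈ xs → P x
    succ∈           : ∀ {x y} → x ∈ xs → x ≢ last → R x y → y ∈ xs
    has-succ        : ∀ {x} → x ∈ xs → x ≢ last → ∃ (R x)
    has-pred        : ∀ {y} → y ∈ xs → y ≢ first → ∃ λ x → x ∈ xs × x ≢ last × R x y
    first-unreached : ∀ {x} → x ∈ xs → x ≢ last → ¬ R x first

record Cycle (R : ℕ → ℕ → Set) (xs : List ℕ) : Set where
  field
    succ∈    : ∀ {x y} → x ∈ xs → R x y → y ∈ xs
    pred∈    : ∀ {x y} → y ∈ xs → R x y → x ∈ xs
    has-succ : ∀ {x} → x ∈ xs → ∃ (R x)
    has-pred : ∀ {y} → y ∈ xs → ∃ λ x → R x y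

Cycle-flip : ∀ {R xs} → Cycle R xs → Cycle (flip R) xs
Cycle-flip c = record { succ∈ = pred∈ ; pred∈ = succ∈ ; has-succ = has-pred ; has-pred = has-succ }
  where open Cycle c

Path-singleton : ∀ {R P a} → P a → Path R P a a (a ∷ [])
Path-singleton Pa = record
  { unique          = [] ∷ []
  ; first∈          = here refl
  ; last∈           = here refl
  ; all-P           = λ { (here refl) → Pa }
  ; succ∈           = λ { (here refl) a≢a → ⊥-elim (a≢a refl) }
  ; has-succ        = λ { (here refl) a≢a → ⊥-elim (a≢a refl) }
  ; has-pred        = λ { (here refl) a≢a → ⊥-elim (a≢a refl) }
  ; first-unreached = λ { (here refl) a≢a → ⊥-elim (a≢a refl) }
  }

module _ {R : ℕ → ℕ → Set} {P : ℕ → Set} {first last : ℕ} {xs : List ℕ}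
         (p : Path R P first last xs) where
  open Path p

  Path-succ-closed : (∀ b → ¬ R last b) → ∀ {x y} → x ∈ xs → R x y → y ∈ xs
  Path-succ-closed stuck {x} x∈ xy with x ≟ last
  ... | yes refl   = ⊥-elim (stuck _ xy)
  ... | no  x≢last = succ∈ x∈ x≢last xy

  Path-pred-closed : Injective R → (∀ a → ¬ R a first) → ∀ {x y} → y ∈ xs → R x y → x ∈ xs
  Path-pred-closed R-injective unreached {y = y} y∈ xy with y ≟ first
  ... | yes refl    = ⊥-elim (unreached _ xy)
  ... | no  y≢first = let (x′ , x′∈ , _ , x′y) = has-pred y∈ y≢first in
                      subst (_∈ xs) (R-injective x′y xy) x′∈

  Path-close : Functional R → Injective R → R last first → Cycle R xs
  Path-close R-functional R-injective closing = record
    { succ∈    = cycle-succ∈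
    ; pred∈    = cycle-pred∈
    ; has-succ = cycle-has-succ
    ; has-pred = cycle-has-pred
    }
    where
    cycle-succ∈ : ∀ {x y} → x ∈ xs → R x y → y ∈ xs
    cycle-succ∈ {x} x∈ xy with x ≟ last
    ... | yes refl   = subst (_∈ xs) (R-functional closing xy) first∈
    ... | no  x≢last = succ∈ x∈ x≢last xy

    cycle-pred∈ : ∀ {x y} → y ∈ xs → R x y → x ∈ xs
    cycle-pred∈ {y = y} y∈ xy with y ≟ first
    ... | yes refl    = subst (_∈ xs) (R-injective closing xy) last∈
    ... | no  y≢first = let (x′ , x′∈ , _ , x′y) = has-pred y∈ y≢first in
                        subst (_∈ xs) (R-injective x′y xy) x′∈

    cycle-has-succ : ∀ {x} → x ∈ xs → ∃ (R x)
    cycle-has-succ {x} x∈ with x ≟ last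
    ... | yes refl   = first , closing
    ... | no  x≢last = has-succ x∈ x≢last

    cycle-has-pred : ∀ {y} → y ∈ xs → ∃ λ x → R x y
    cycle-has-pred {y} y∈ with y ≟ first
    ... | yes refl    = last , closing
    ... | no  y≢first = let (x , _ , _ , xy) = has-pred y∈ y≢first in x , xy

  Path-flip : Injective R → (∀ b → ¬ R last b) → Path (flip R) P last first xs
  Path-flip R-injective stuck = record
    { unique          = unique
    ; first∈          = last∈
    ; last∈           = first∈
    ; all-P           = all-P
    ; succ∈           = λ x∈ x≢first yx → let (x′ , x′∈ , _ , x′x) = has-pred x∈ x≢first in
                                          subst (_∈ xs) (R-injective x′x yx) x′∈
    ; has-succ        = λ x∈ x≢first → let (x′ , _ , _ , x′x) = has-pred x∈ x≢first in x′ , x′x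
    ; has-pred        = λ y∈ y≢last → let (x , yx) = has-succ y∈ y≢last in
                          x , succ∈ y∈ y≢last yx ,
                          (λ x≡first → first-unreached y∈ y≢last (subst (R _) x≡first yx)) , yx
    ; first-unreached = λ _ _ → stuck _
    }

  Path-extend : Functional R → (∀ {a b} → P a → R a b → P b) →
                ∀ {y} → R last y → y ∉ xs → Path R P first y (y ∷ xs)
  Path-extend R-functional R-preserves-P {y} last-y y∉ = record
    { unique          = ¬Any⇒All¬ xs y∉ ∷ unique
    ; first∈          = there first∈
    ; last∈           = here refl
    ; all-P           = λ { (here refl) → R-preserves-P (all-P last∈) last-y
                          ; (there x∈)  → all-P x∈ }
    ; succ∈           = extended-succ∈
    ; has-succ        = extended-has-succ
    ; has-pred        = extended-has-pred
    ; first-unreached = extended-first-unreached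
    }
    where
    ∈⇒≢y : ∀ {x} → x ∈ xs → x ≢ y
    ∈⇒≢y x∈ refl = y∉ x∈

    extended-succ∈ : ∀ {x z} → x ∈ y ∷ xs → x ≢ y → R x z → z ∈ y ∷ xs
    extended-succ∈ (here refl) x≢y _ = ⊥-elim (x≢y refl)
    extended-succ∈ {x} (there x∈) _ xz with x ≟ last
    ... | yes refl   = here (R-functional xz last-y)
    ... | no  x≢last = there (succ∈ x∈ x≢last xz)

    extended-has-succ : ∀ {x} → x ∈ y ∷ xs → x ≢ y → ∃ (R x)
    extended-has-succ (here refl) x≢y = ⊥-elim (x≢y refl)
    extended-has-succ {x} (there x∈) _ with x ≟ last
    ... | yes refl   = y , last-y
    ... | no  x≢last = has-succ x∈ x≢last

    extended-has-pred : ∀ {z} → z ∈ y ∷ xs → z ≢ first → ∃ λ x → x ∈ y ∷ xs × x ≢ y × R x z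
    extended-has-pred (here refl) _ = last , there last∈ , ∈⇒≢y last∈ , last-y
    extended-has-pred (there z∈) z≢first =
      let (x , x∈ , _ , xz) = has-pred z∈ z≢first in x , there x∈ , ∈⇒≢y x∈ , xz

    extended-first-unreached : ∀ {x} → x ∈ y ∷ xs → x ≢ y → ¬ R x first
    extended-first-unreached (here refl) x≢y = ⊥-elim (x≢y refl)
    extended-first-unreached {x} (there x∈) _ with x ≟ last
    ... | yes refl   = λ x-first → y∉ (subst (_∈ xs) (R-functional x-first last-y) first∈)
    ... | no  x≢last = first-unreached x∈ x≢last

  Path-length : (dom : List ℕ) → (∀ {a b} → R a b → a ∈ dom) → length xs ≤ suc (length dom)
  Path-length dom R⇒dom = Unique-⊆⇒length≤ unique xs⊆last∷dom
    where
    xs⊆last∷dom : xs ⊆ last ∷ dom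
    xs⊆last∷dom {x} x∈ with x ≟ last
    ... | yes refl   = here refl
    ... | no  x≢last = there (R⇒dom (proj₂ (has-succ x∈ x≢last)))

data Walk (R : ℕ → ℕ → Set) (P : ℕ → Set) (first : ℕ) (xs₀ : List ℕ) : Set where
  closes : ∀ {last xs} → Path R P first last xs → R last first →
           xs₀ ⊆ xs → Walk R P first xs₀
  stops  : ∀ {last xs} → Path R P first last xs → (∀ b → ¬ R last b) →
           xs₀ ⊆ xs → Walk R P first xs₀

module _ {R : ℕ → ℕ → Set} {P : ℕ → Set}
         (R-functional : Functional R) (R-injective : Injective R)
         (R-preserves-P : ∀ {a b} → P a → R a b → P b) (succ? : ∀ a → Dec (∃ (R a)))
         (dom : List ℕ) (R⇒dom : ∀ {a b} → R a b → a ∈ dom) where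

  -- The fuel bound makes the fuel-exhausted case contradict Path-length.
  walk : ∀ fuel {first last xs} → Path R P first last xs → suc (length dom) < length xs + fuel →
         Walk R P first xs
  walk zero {xs = xs} p bound =
    ⊥-elim (<⇒≱ (subst (suc (length dom) <_) (+-identityʳ (length xs)) bound)
                (Path-length p dom R⇒dom))
  walk (suc fuel) {first} {last} {xs} p bound with succ? last
  ... | no  stuck        = stops p (λ b r → stuck (b , r)) (λ x∈ → x∈)
  ... | yes (y , last-y) with Any.any? (y ≟_) xs
  ...   | yes y∈ = closes p (subst (R last) y≡first last-y) (λ x∈ → x∈)
    where
    open Path p
    y≡first : y ≡ first
    y≡first with y ≟ first
    ... | yes y≡first = y≡first
    ... | no  y≢first = let (_ , _ , x≢last , xy) = has-pred y∈ y≢first in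
                        ⊥-elim (x≢last (R-injective xy last-y))
  ...   | no  y∉ with walk fuel (Path-extend p R-functional R-preserves-P last-y y∉)
                          (subst (suc (length dom) <_) (+-suc (length xs) fuel) bound)
  ...     | closes p′ closing xs⊆ = closes p′ closing (xs⊆ ∘ there)
  ...     | stops  p′ stuck   xs⊆ = stops  p′ stuck   (xs⊆ ∘ there)

Cycle⇒Closed : ∀ {s n xs} → Cycle (_↦[ s ]_) xs → n ∈ xs → Closed s n
Cycle⇒Closed {xs = xs} c n∈ m o = has-succ m∈ , has-pred m∈
  where
  open Cycle c
  m∈ : m ∈ xs
  m∈ = Orb-least (_∈ xs) n∈ succ∈ pred∈ o

record OrbitPath (s : FPInj) (n : ℕ) : Set where
  field
    ps           : List ℕ
    a₀ aⱼ        : ℕ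
    path         : Path (_↦[ s ]_) (Orb s n) a₀ aⱼ ps
    n∈ps         : n ∈ ps
    a₀-unreached : ∀ a → ¬ a ↦[ s ] a₀
    aⱼ-stuck     : ∀ b → ¬ aⱼ ↦[ s ] b

-- Walk backwards from n until stuck at a₀ (returning to n would close the orbit), then
-- forwards from a₀; the latter walk cannot close up since a₀ has no predecessor.
orbitPath : ∀ s n → ¬ InClosedOrbit s n → OrbitPath s n
orbitPath s n n∉closed
  with walk (↦-injective s) (↦-functional s) bwd (inRan? s)
            (map proj₂ (graph s)) (∈-map⁺ proj₂) (suc (length (map proj₂ (graph s))))
            (Path-singleton here) ≤-refl
... | closes back closing _ =
  let cycle = Cycle-flip (Path-close back (↦-injective s) (↦-functional s) closing) in
  ⊥-elim (n∉closed (n , Cycle⇒Closed cycle (Path.first∈ back) , here))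
... | stops back a₀-unreached xs₁⊆
  with walk (↦-functional s) (↦-injective s) fwd (inDom? s)
            (map proj₁ (graph s)) (∈-map⁺ proj₁) (suc (suc (length (map proj₁ (graph s)))))
            (Path-flip back (↦-functional s) a₀-unreached) (m≤n+m _ _)
...   | closes _ closing _ = ⊥-elim (a₀-unreached _ closing)
...   | stops forth aⱼ-stuck xs⊆ = record
  { path         = forth
  ; n∈ps         = xs⊆ (xs₁⊆ (here refl))
  ; a₀-unreached = a₀-unreached
  ; aⱼ-stuck     = aⱼ-stuck
  }

record CofinitaryMap : Set where
  field
    apply         : ℕ → ℕ
    retract       : ℕ → ℕ
    retract-apply : ∀ x → retract (apply x) ≡ x
    fixedPoints   : List ℕ
    fixed⇒∈       : ∀ x → apply x ≡ x → x ∈ fixedPoints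

open CofinitaryMap

module FreshPoints (old : List ℕ) (maps : List CofinitaryMap) where

  forbidden : List ℕ
  forbidden = old ++ concatMap (λ g → map (apply g) old ++ map (retract g) old ++ fixedPoints g) maps

  neighbours : ℕ → List ℕ
  neighbours p = p ∷ concatMap (λ g → apply g p ∷ retract g p ∷ []) maps

  -- Opaque since unfolding b during unification is prohibitively expensive.
  opaque
    earlier : ℕ → List ℕ
    b : ℕ → ℕ
    earlier zero    = []
    earlier (suc i) = b i ∷ earlier i
    b i = suc (max 0 (forbidden ++ concatMap neighbours (earlier i)))

    below-b : ∀ {x} i → x ∈ forbidden ++ concatMap neighbours (earlier i) → x < b i
    below-b i x∈ = s≤s (All.lookup (xs≤max 0 _) x∈)

    earlier-∈ : ∀ {j i} → j < i → b j ∈ earlier i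
    earlier-∈ {j} {suc i} (s≤s j≤i) with j ≟ i
    ... | yes refl = here refl
    ... | no  j≢i  = there (earlier-∈ (≤∧≢⇒< j≤i j≢i))

  forbidden<b : ∀ {x} i → x ∈ forbidden → x < b i
  forbidden<b i x∈ = below-b i (∈-++⁺ˡ x∈)

  neighbour<b : ∀ {j i x} → j < i → x ∈ neighbours (b j) → x < b i
  neighbour<b {i = i} j<i x∈ =
    below-b i (∈-++⁺ʳ forbidden (∈-concatMap⁺′ neighbours x∈ (earlier-∈ j<i)))

  b-increasing : ∀ {j i} → j < i → b j < b i
  b-increasing j<i = neighbour<b j<i (here refl)

  b-injective : ∀ {i j} → b i ≡ b j → i ≡ j
  b-injective {i} {j} eq with <-cmp i j
  ... | tri< i<j _ _ = ⊥-elim (<-irrefl eq (b-increasing i<j))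
  ... | tri≈ _ i≡j _ = i≡j
  ... | tri> _ _ j<i = ⊥-elim (<-irrefl (sym eq) (b-increasing j<i))

  private
    forbidden-via : ∀ {g x} → g ∈ maps →
                    x ∈ map (apply g) old ++ map (retract g) old ++ fixedPoints g → x ∈ forbidden
    forbidden-via g∈ x∈ = ∈-++⁺ʳ old (∈-concatMap⁺′ _ x∈ g∈)

    neighbour-via : ∀ {g p x} → g ∈ maps → x ∈ apply g p ∷ retract g p ∷ [] → x ∈ neighbours p
    neighbour-via g∈ x∈ = there (∈-concatMap⁺′ _ x∈ g∈)

    b≡retract : ∀ {g x} i → apply g (b i) ≡ x → b i ≡ retract g x
    b≡retract {g} i eq = trans (sym (retract-apply g (b i))) (cong (retract g) eq)

  old<b : ∀ {u} i → u ∈ old → u < b i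
  old<b i u∈ = forbidden<b i (∈-++⁺ˡ u∈)

  apply-old<b : ∀ {g u} i → g ∈ maps → u ∈ old → apply g u < b i
  apply-old<b {g} i g∈ u∈ = forbidden<b i (forbidden-via {g} g∈ (∈-++⁺ˡ (∈-map⁺ (apply g) u∈)))

  apply-b∉old : ∀ {g u} i → g ∈ maps → u ∈ old → apply g (b i) ≢ u
  apply-b∉old {g} {u} i g∈ u∈ eq = <-irrefl (sym (b≡retract {g} i eq))
    (forbidden<b i (forbidden-via {g} g∈
      (∈-++⁺ʳ (map (apply g) old) (∈-++⁺ˡ (∈-map⁺ (retract g) u∈)))))

  apply-b≢b : ∀ {g} i j → g ∈ maps → apply g (b i) ≢ b j
  apply-b≢b {g} i j g∈ eq with <-cmp i j
  ... | tri< i<j _ _    = <-irrefl eq (neighbour<b i<j (neighbour-via {g} g∈ (here refl)))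
  ... | tri> _ _ j<i    = <-irrefl (sym (b≡retract {g} i eq))
                            (neighbour<b j<i (neighbour-via {g} g∈ (there (here refl))))
  ... | tri≈ _ refl _   = <-irrefl refl (forbidden<b i (forbidden-via {g} g∈
                            (∈-++⁺ʳ (map (apply g) old)
                              (∈-++⁺ʳ (map (retract g) old) (fixed⇒∈ g (b i) eq)))))

blockWord : ∀ {G} → Block G → Word
blockWord bl = gl (Block.g bl) ∷ xpow (Block.k bl)

module _ {G : CofinitaryGroup} (maps : List CofinitaryMap) (bound : ℕ) where

  Listed : (ℕ → ℕ) → Set
  Listed g = ∃ λ r → r ∈ maps × apply r ≡ g

  AdmissibleBlock : Block G → Set
  AdmissibleBlock bl = Listed (Block.g bl) × ∣ Block.k bl ∣ ≤ bound

  Admissible : NiceWord G → Set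
  Admissible (powX k _)              = k ≤ bound
  Admissible (gWord bls g₀ _ _ k₀ _) = Listed g₀ × k₀ ≤ bound × All AdmissibleBlock bls

module _ {G : CofinitaryGroup} where

  cofinitaryMap : ∀ {g} → member G g → ¬ IsId g → CofinitaryMap
  cofinitaryMap {g} g∈G g≠id = record
    { apply         = g
    ; retract       = proj₁ (inv-mem G g∈G)
    ; retract-apply = proj₁ (proj₂ (proj₂ (inv-mem G g∈G)))
    ; fixedPoints   = proj₁ (cofinitary G g∈G g≠id)
    ; fixed⇒∈       = proj₂ (cofinitary G g∈G g≠id)
    }

  blockMap : Block G → CofinitaryMap
  blockMap bl = cofinitaryMap (Block.g∈G bl) (Block.g≠id bl)

  wordMaps : NiceWord G → List CofinitaryMap
  wordMaps (powX _ _)                   = []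
  wordMaps (gWord bls _ g₀∈G g₀≠id _ _) = cofinitaryMap g₀∈G g₀≠id ∷ map blockMap bls

  blockExponent : Block G → ℕ
  blockExponent bl = ∣ Block.k bl ∣

  exponents : NiceWord G → List ℕ
  exponents (powX k _)              = k ∷ []
  exponents (gWord bls _ _ _ k₀ _) = k₀ ∷ map blockExponent bls

  allMaps : List (NiceWord G) → List CofinitaryMap
  allMaps = concatMap wordMaps

  maxExponent : List (NiceWord G) → ℕ
  maxExponent E = max 0 (concatMap exponents E)

  admissible : ∀ E {bound} → maxExponent E ≤ bound → All (Admissible (allMaps E) bound) E
  admissible E {bound} max≤ = All.tabulate admissible-word
    where
    exponent≤ : ∀ {w k} → w ∈ E → k ∈ exponents w → k ≤ bound
    exponent≤ w∈ k∈ = ≤-trans (All.lookup (xs≤max 0 _) (∈-concatMap⁺′ exponents k∈ w∈)) max≤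

    listed : ∀ {w r} → w ∈ E → r ∈ wordMaps w → r ∈ allMaps E
    listed w∈ r∈ = ∈-concatMap⁺′ wordMaps r∈ w∈

    admissible-word : ∀ {w} → w ∈ E → Admissible (allMaps E) bound w
    admissible-word {powX k _} w∈ = exponent≤ w∈ (here refl)
    admissible-word {gWord bls _ _ _ _ _} w∈ =
      (_ , listed w∈ (here refl) , refl) , exponent≤ w∈ (here refl) ,
      All.tabulate (λ bl∈ → (_ , listed w∈ (there (∈-map⁺ blockMap bl∈)) , refl) ,
                            exponent≤ w∈ (there (∈-map⁺ blockExponent bl∈)))

module Extension (s : FPInj) (n : ℕ) (O : OrbitPath s n) (maps : List CofinitaryMap) (m′ : ℕ) where
  open OrbitPath O
  open Path path

  old : List ℕ
  old = n ∷ points s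

  open FreshPoints old maps

  Old : ℕ → Set
  Old x = ∀ q → x ≢ b q

  Fresh : ℕ → Set
  Fresh x = ∃ λ q → q ≤ m′ × x ≡ b q

  old⇒Old : ∀ {x} → x ∈ old → Old x
  old⇒Old x∈ q refl = <-irrefl refl (old<b q x∈)

  orbit⊆old : ∀ {x} → Orb s n x → x ∈ old
  orbit⊆old = Orb-least (_∈ old) (here refl)
                (λ _ ab → there (ran∈points s ab)) (λ _ ba → there (dom∈points s ba))

  ps⊆old : ∀ {x} → x ∈ ps → x ∈ old
  ps⊆old x∈ = orbit⊆old (all-P x∈)

  a₀-Old : Old a₀
  a₀-Old = old⇒Old (ps⊆old first∈)

  aⱼ-Old : Old aⱼ
  aⱼ-Old = old⇒Old (ps⊆old last∈)

  dom-Old : ∀ {u v} → u ↦[ s ] v → Old u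
  dom-Old uv = old⇒Old (there (dom∈points s uv))

  ran-Old : ∀ {u v} → u ↦[ s ] v → Old v
  ran-Old uv = old⇒Old (there (ran∈points s uv))

  newEdges : List (ℕ × ℕ)
  newEdges = (aⱼ , b 0) ∷ (b m′ , a₀) ∷ applyUpTo (λ q → b q , b (suc q)) m′

  data NewEdge : ℕ → ℕ → Set where
    enter   : NewEdge aⱼ (b 0)
    leave   : NewEdge (b m′) a₀
    advance : ∀ {q} → q < m′ → NewEdge (b q) (b (suc q))

  newEdge⁻ : ∀ {u v} → (u , v) ∈ newEdges → NewEdge u v
  newEdge⁻ (here refl)         = enter
  newEdge⁻ (there (here refl)) = leave
  newEdge⁻ (there (there e∈)) with ∈-applyUpTo⁻ _ e∈
  ... | q , q<m′ , refl = advance q<m′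

  newEdge⁺ : ∀ {u v} → NewEdge u v → (u , v) ∈ newEdges
  newEdge⁺ enter          = here refl
  newEdge⁺ leave          = there (here refl)
  newEdge⁺ (advance q<m′) = there (there (∈-applyUpTo⁺ _ q<m′))

  newEdges-dom-unique : Unique (map proj₁ newEdges)
  newEdges-dom-unique rewrite map-applyUpTo (λ q → b q , b (suc q)) proj₁ m′ =
    (aⱼ-Old m′ ∷ applyUpTo⁺₁ b m′ (λ _ → aⱼ-Old _)) ∷
    applyUpTo⁺₁ b m′ (λ q<m′ → <⇒≢ (b-increasing q<m′) ∘ sym) ∷
    Unique.applyUpTo⁺₁ b m′ (λ i<j _ → <⇒≢ (b-increasing i<j))

  newEdges-ran-unique : Unique (map proj₂ newEdges)
  newEdges-ran-unique rewrite map-applyUpTo (λ q → b q , b (suc q)) proj₂ m′ =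
    ((a₀-Old 0 ∘ sym) ∷ applyUpTo⁺₁ (b ∘ suc) m′ (λ _ → <⇒≢ (b-increasing z<s))) ∷
    applyUpTo⁺₁ (b ∘ suc) m′ (λ _ → a₀-Old _) ∷
    Unique.applyUpTo⁺₁ (b ∘ suc) m′ (λ i<j _ → <⇒≢ (b-increasing (s<s i<j)))

  t : FPInj
  t = mkFPInj (graph s ++ newEdges) dom-unique ran-unique
    where
    dom-unique : Unique (map proj₁ (graph s ++ newEdges))
    dom-unique = subst Unique (sym (map-++ proj₁ (graph s) newEdges))
      (Unique.++⁺ (injDom s) newEdges-dom-unique disjoint)
      where
      disjoint : ∀ {u} → ¬ (u ∈ map proj₁ (graph s) × u ∈ map proj₁ newEdges)
      disjoint (u∈ , u∈new) with ∈-map⁻ proj₁ u∈ | ∈-map⁻ proj₁ u∈new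
      ... | (_ , v) , uv , refl | _ , e∈ , refl with newEdge⁻ e∈
      ...   | enter         = aⱼ-stuck v uv
      ...   | leave         = dom-Old uv m′ refl
      ...   | advance {q} _ = dom-Old uv q refl

    ran-unique : Unique (map proj₂ (graph s ++ newEdges))
    ran-unique = subst Unique (sym (map-++ proj₂ (graph s) newEdges))
      (Unique.++⁺ (injRan s) newEdges-ran-unique disjoint)
      where
      disjoint : ∀ {v} → ¬ (v ∈ map proj₂ (graph s) × v ∈ map proj₂ newEdges)
      disjoint (v∈ , v∈new) with ∈-map⁻ proj₂ v∈ | ∈-map⁻ proj₂ v∈new
      ... | (u , _) , uv , refl | _ , e∈ , refl with newEdge⁻ e∈
      ...   | enter         = ran-Old uv 0 refl
      ...   | leave         = a₀-unreached u uv
      ...   | advance {q} _ = ran-Old uv (suc q) refl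

  s⊑t : s ⊑ t
  s⊑t = ∈-++⁺ˡ

  newEdge⇒t : ∀ {u v} → NewEdge u v → u ↦[ t ] v
  newEdge⇒t e = ∈-++⁺ʳ (graph s) (newEdge⁺ e)

  t-edge⁻ : ∀ {u v} → u ↦[ t ] v → u ↦[ s ] v ⊎ NewEdge u v
  t-edge⁻ uv with ∈-++⁻ (graph s) uv
  ... | inj₁ uv-s = inj₁ uv-s
  ... | inj₂ e∈   = inj₂ (newEdge⁻ e∈)

  OnCycle : ℕ → Set
  OnCycle x = x ∈ ps ⊎ Fresh x

  newEdge-ends : ∀ {u v} → NewEdge u v → OnCycle u × OnCycle v
  newEdge-ends enter          = inj₁ last∈ , inj₂ (0 , z≤n , refl)
  newEdge-ends leave          = inj₂ (m′ , ≤-refl , refl) , inj₁ first∈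
  newEdge-ends (advance q<m′) = inj₂ (_ , <⇒≤ q<m′ , refl) , inj₂ (_ , q<m′ , refl)

  orbit⊆cycle : ∀ {x} → Orb t n x → OnCycle x
  orbit⊆cycle = Orb-least OnCycle (inj₁ n∈ps) forward backward
    where
    forward : ∀ {u v} → OnCycle u → u ↦[ t ] v → OnCycle v
    forward u∈ uv with t-edge⁻ uv
    ... | inj₂ e = proj₂ (newEdge-ends e)
    ... | inj₁ uv-s with u∈
    ...   | inj₁ u∈ps           = inj₁ (Path-succ-closed path aⱼ-stuck u∈ps uv-s)
    ...   | inj₂ (q , _ , refl) = ⊥-elim (dom-Old uv-s q refl)
    backward : ∀ {u v} → OnCycle u → v ↦[ t ] u → OnCycle v
    backward u∈ vu with t-edge⁻ vu
    ... | inj₂ e = proj₁ (newEdge-ends e)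
    ... | inj₁ vu-s with u∈
    ...   | inj₁ u∈ps           = inj₁ (Path-pred-closed path (↦-injective s) a₀-unreached u∈ps vu-s)
    ...   | inj₂ (q , _ , refl) = ⊥-elim (ran-Old vu-s q refl)

  fresh-in-orbit : ∀ {q} → q ≤ m′ → Orb t n (b q)
  fresh-in-orbit {zero}  _    = fwd (Orb-mono s⊑t (all-P last∈)) (newEdge⇒t enter)
  fresh-in-orbit {suc q} q<m′ = fwd (fresh-in-orbit (<⇒≤ q<m′)) (newEdge⇒t (advance q<m′))

  cycle⊆orbit : ∀ {x} → OnCycle x → Orb t n x
  cycle⊆orbit (inj₁ x∈ps)              = Orb-mono s⊑t (all-P x∈ps)
  cycle⊆orbit (inj₂ (_ , q≤m′ , refl)) = fresh-in-orbit q≤m′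

  orbit-card : HasCard (Orb t n) (length ps + suc m′)
  orbit-card = ps ++ applyUpTo b (suc m′) , unique-cycle , length-cycle ,
               λ x → mk⇔ (cycle⊆orbit ∘ listed⇒OnCycle) (OnCycle⇒listed ∘ orbit⊆cycle)
    where
    unique-cycle : Unique (ps ++ applyUpTo b (suc m′))
    unique-cycle = Unique.++⁺ unique
      (Unique.applyUpTo⁺₁ b (suc m′) (λ i<j _ → <⇒≢ (b-increasing i<j)))
      (λ (x∈ps , x∈fresh) → let (q , _ , x≡bq) = ∈-applyUpTo⁻ b x∈fresh in
                            old⇒Old (ps⊆old x∈ps) q x≡bq)
    length-cycle : length (ps ++ applyUpTo b (suc m′)) ≡ length ps + suc m′
    length-cycle = trans (length-++ ps) (cong (λ k → length ps + k) (length-applyUpTo b (suc m′)))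
    listed⇒OnCycle : ∀ {x} → x ∈ ps ++ applyUpTo b (suc m′) → OnCycle x
    listed⇒OnCycle x∈ with ∈-++⁻ ps x∈
    ... | inj₁ x∈ps    = inj₁ x∈ps
    ... | inj₂ x∈fresh = let (q , q<sm′ , x≡bq) = ∈-applyUpTo⁻ b x∈fresh in
                         inj₂ (q , s≤s⁻¹ q<sm′ , x≡bq)
    OnCycle⇒listed : ∀ {x} → OnCycle x → x ∈ ps ++ applyUpTo b (suc m′)
    OnCycle⇒listed (inj₁ x∈ps)              = ∈-++⁺ˡ x∈ps
    OnCycle⇒listed (inj₂ (_ , q≤m′ , refl)) = ∈-++⁺ʳ ps (∈-applyUpTo⁺ b (s≤s q≤m′))

  ps-in-dom : ∀ {x} → x ∈ ps → InDom t x
  ps-in-dom {x} x∈ps with x ≟ aⱼ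
  ... | yes refl = b 0 , newEdge⇒t enter
  ... | no  x≢aⱼ = let (y , xy) = has-succ x∈ps x≢aⱼ in y , s⊑t xy

  ps-in-ran : ∀ {x} → x ∈ ps → InRan t x
  ps-in-ran {x} x∈ps with x ≟ a₀
  ... | yes refl = b m′ , newEdge⇒t leave
  ... | no  x≢a₀ = let (y , _ , _ , yx) = has-pred x∈ps x≢a₀ in y , s⊑t yx

  fresh-in-dom : ∀ {q} → q ≤ m′ → InDom t (b q)
  fresh-in-dom q≤m′ with m≤n⇒m<n∨m≡n q≤m′
  ... | inj₁ q<m′ = _ , newEdge⇒t (advance q<m′)
  ... | inj₂ refl = a₀ , newEdge⇒t leave

  fresh-in-ran : ∀ {q} → q ≤ m′ → InRan t (b q)
  fresh-in-ran {zero}  _    = aⱼ , newEdge⇒t enter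
  fresh-in-ran {suc q} q<m′ = b q , newEdge⇒t (advance q<m′)

  t-closed : Closed t n
  t-closed x o with orbit⊆cycle o
  ... | inj₁ x∈ps              = ps-in-dom x∈ps , ps-in-ran x∈ps
  ... | inj₂ (q , q≤m′ , refl) = fresh-in-dom q≤m′ , fresh-in-ran q≤m′

  field-old-or-fresh : ∀ {x} → InField t x → x ∈ old ⊎ Fresh x
  field-old-or-fresh (inj₁ (_ , xy)) with t-edge⁻ xy
  ... | inj₁ xy-s = inj₁ (there (dom∈points s xy-s))
  ... | inj₂ e with proj₁ (newEdge-ends e)
  ...   | inj₁ x∈ps   = inj₁ (ps⊆old x∈ps)
  ...   | inj₂ fresh  = inj₂ fresh
  field-old-or-fresh (inj₂ (_ , yx)) with t-edge⁻ yx
  ... | inj₁ yx-s = inj₁ (there (ran∈points s yx-s))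
  ... | inj₂ e with proj₂ (newEdge-ends e)
  ...   | inj₁ x∈ps   = inj₁ (ps⊆old x∈ps)
  ...   | inj₂ fresh  = inj₂ fresh

  step-from-old : ∀ {u v} → Old u → u ↦[ t ] v → u ↦[ s ] v ⊎ (u ≡ aⱼ × v ≡ b 0)
  step-from-old old-u uv with t-edge⁻ uv
  ... | inj₁ uv-s            = inj₁ uv-s
  ... | inj₂ enter           = inj₂ (refl , refl)
  ... | inj₂ leave           = ⊥-elim (old-u m′ refl)
  ... | inj₂ (advance {q} _) = ⊥-elim (old-u q refl)

  step-into-old : ∀ {u v} → Old v → u ↦[ t ] v → u ↦[ s ] v ⊎ (v ≡ a₀ × u ≡ b m′)
  step-into-old old-v uv with t-edge⁻ uv
  ... | inj₁ uv-s            = inj₁ uv-s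
  ... | inj₂ enter           = ⊥-elim (old-v 0 refl)
  ... | inj₂ leave           = inj₂ (refl , refl)
  ... | inj₂ (advance {q} _) = ⊥-elim (old-v (suc q) refl)

  step-from-fresh : ∀ {q u v} → u ↦[ t ] v → u ≡ b q →
                    (q < m′ × v ≡ b (suc q)) ⊎ (q ≡ m′ × v ≡ a₀)
  step-from-fresh {q} uv u≡bq with t-edge⁻ uv
  ... | inj₁ uv-s              = ⊥-elim (dom-Old uv-s q u≡bq)
  ... | inj₂ enter             = ⊥-elim (aⱼ-Old q u≡bq)
  ... | inj₂ leave             = inj₂ (b-injective (sym u≡bq) , refl)
  ... | inj₂ (advance q′<m′) with b-injective u≡bq
  ...   | refl = inj₁ (q′<m′ , refl)

  step-into-fresh : ∀ {q u v} → u ↦[ t ] v → v ≡ b q →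
                    (q ≡ 0 × u ≡ aⱼ) ⊎ ∃ λ q′ → q ≡ suc q′ × u ≡ b q′
  step-into-fresh {q} uv v≡bq with t-edge⁻ uv
  ... | inj₁ uv-s        = ⊥-elim (ran-Old uv-s q v≡bq)
  ... | inj₂ enter       = inj₁ (b-injective (sym v≡bq) , refl)
  ... | inj₂ leave       = ⊥-elim (a₀-Old q v≡bq)
  ... | inj₂ (advance _) = inj₂ (_ , b-injective (sym v≡bq) , refl)

  forward-from-old : ∀ r {u c} → Old u → r ≤ suc m′ → Eval t (replicate r xl) u c →
                     (Eval s (replicate r xl) u c × Old c) ⊎ ∃ λ q → q < r × c ≡ b q
  forward-from-old zero    old-u _   refl = inj₁ (refl , old-u)
  forward-from-old (suc r) old-u r< (c₁ , run , step) with forward-from-old r old-u (<⇒≤ r<) run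
  ... | inj₁ (run-s , old-c₁) with step-from-old old-c₁ step
  ...   | inj₁ step-s    = inj₁ ((c₁ , run-s , step-s) , ran-Old step-s)
  ...   | inj₂ (_ , refl) = inj₂ (0 , z<s , refl)
  forward-from-old (suc r) old-u r< (c₁ , run , step) | inj₂ (q , q<r , c₁≡bq)
    with step-from-fresh step c₁≡bq
  ... | inj₁ (_ , refl) = inj₂ (suc q , s<s q<r , refl)
  ... | inj₂ (refl , _) = ⊥-elim (<⇒≱ q<r (s≤s⁻¹ r<))

  backward-from-old : ∀ r {u c} → Old u → r ≤ suc m′ → Eval t (replicate r xi) u c →
                      (Eval s (replicate r xi) u c × Old c) ⊎ ∃ λ q → m′ < q + r × c ≡ b q
  backward-from-old zero    old-u _   refl = inj₁ (refl , old-u)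
  backward-from-old (suc r) old-u r< (c₁ , run , step) with backward-from-old r old-u (<⇒≤ r<) run
  ... | inj₁ (run-s , old-c₁) with step-into-old old-c₁ step
  ...   | inj₁ step-s     = inj₁ ((c₁ , run-s , step-s) , dom-Old step-s)
  ...   | inj₂ (_ , refl) = inj₂ (m′ , m<m+n m′ z<s , refl)
  backward-from-old (suc r) old-u r< (c₁ , run , step) | inj₂ (q , m′<q+r , c₁≡bq)
    with step-into-fresh step c₁≡bq
  ... | inj₁ (refl , refl)        = ⊥-elim (<⇒≱ m′<q+r (s≤s⁻¹ r<))
  ... | inj₂ (q′ , refl , refl)   = inj₂ (q′ , subst (m′ <_) (sym (+-suc q′ r)) m′<q+r , refl)

  -- Starting at b p, a run re-enters the fresh points only after passing a₀ ⋯ aⱼ.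
  forward-from-fresh : ∀ r {p c} → p ≤ m′ → Eval t (replicate r xl) (b p) c →
                       (r + p ≤ m′ × c ≡ b (r + p)) ⊎ (m′ < r + p × Old c) ⊎
                       ∃ λ q → suc (q + m′) < r + p × c ≡ b q
  forward-from-fresh zero p≤m′ refl = inj₁ (p≤m′ , refl)
  forward-from-fresh (suc r) p≤m′ (c₁ , run , step) with forward-from-fresh r p≤m′ run
  ... | inj₁ (_ , c₁≡b) with step-from-fresh step c₁≡b
  ...   | inj₁ (r+p<m′ , refl) = inj₁ (r+p<m′ , refl)
  ...   | inj₂ (r+p≡m′ , refl) = inj₂ (inj₁ (s≤s (≤-reflexive (sym r+p≡m′)) , a₀-Old))
  forward-from-fresh (suc r) p≤m′ (c₁ , run , step) | inj₂ (inj₁ (m′<r+p , old-c₁))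
    with step-from-old old-c₁ step
  ... | inj₁ step-s     = inj₂ (inj₁ (m<n⇒m<1+n m′<r+p , ran-Old step-s))
  ... | inj₂ (_ , refl) = inj₂ (inj₂ (0 , s≤s m′<r+p , refl))
  forward-from-fresh (suc r) p≤m′ (c₁ , run , step) | inj₂ (inj₂ (q , bound , c₁≡bq))
    with step-from-fresh step c₁≡bq
  ... | inj₁ (_ , refl)    = inj₂ (inj₂ (suc q , s≤s bound , refl))
  ... | inj₂ (refl , refl) =
    inj₂ (inj₁ (m<n⇒m<1+n (≤-trans (s≤s (m≤n+m m′ q)) (<⇒≤ bound)) , a₀-Old))

  power-fix : ∀ k {a} → 0 < k → k ≤ suc m′ → Fix t (replicate k xl) a → Fix s (replicate k xl) a
  power-fix (suc k) _ k≤ run with field-old-or-fresh (inj₁ (proj₁ (x-run-ends k run)))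
  ... | inj₁ a∈old with forward-from-old (suc k) (old⇒Old a∈old) k≤ run
  ...   | inj₁ (run-s , _)    = run-s
  ...   | inj₂ (q , _ , a≡bq) = ⊥-elim (old⇒Old a∈old q a≡bq)
  power-fix (suc k) _ k≤ run | inj₂ (p , p≤m′ , refl)
    with forward-from-fresh (suc k) p≤m′ run
  ... | inj₁ (_ , bp≡b)              = ⊥-elim (m≢1+n+m p (b-injective bp≡b))
  ... | inj₂ (inj₁ (_ , old-bp))     = ⊥-elim (old-bp p refl)
  ... | inj₂ (inj₂ (q , bound , bp≡bq)) with b-injective bp≡bq
  ...   | refl = ⊥-elim (<-irrefl (+-comm p m′) (s≤s⁻¹ (≤-trans bound (+-monoˡ-≤ p k≤))))

  map-safe : ∀ {g u} → g ∈ maps → InField t u → InField t (apply g u) → Old u × Old (apply g u)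
  map-safe g∈ u∈ gu∈ with field-old-or-fresh u∈
  ... | inj₁ u∈old = old⇒Old u∈old , λ q gu≡bq → <-irrefl gu≡bq (apply-old<b q g∈ u∈old)
  ... | inj₂ (q , _ , refl) with field-old-or-fresh gu∈
  ...   | inj₁ gu∈old          = ⊥-elim (apply-b∉old q g∈ gu∈old refl)
  ...   | inj₂ (q′ , _ , gu≡b) = ⊥-elim (apply-b≢b q q′ g∈ gu≡b)

  xpow-in-s : ∀ k {u c} → Old u → Old c → ∣ k ∣ ≤ suc m′ →
              Eval t (xpow k) u c → Eval s (xpow k) u c
  xpow-in-s (+ r) old-u old-c r≤ run with forward-from-old r old-u r≤ run
  ... | inj₁ (run-s , _)    = run-s
  ... | inj₂ (q , _ , c≡bq) = ⊥-elim (old-c q c≡bq)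
  xpow-in-s -[1+ r ] old-u old-c r≤ run with backward-from-old (suc r) old-u r≤ run
  ... | inj₁ (run-s , _)    = run-s
  ... | inj₂ (q , _ , c≡bq) = ⊥-elim (old-c q c≡bq)

  module _ {G : CofinitaryGroup} where

    blocks-start-in-field : ∀ (bls : List (Block G)) {p c} → InField t c →
                            Eval t (concatMap blockWord bls) p c → InField t p
    blocks-start-in-field []         c∈ refl = c∈
    blocks-start-in-field (bl ∷ bls) c∈ run with Eval-++⁻ (blockWord bl) run
    ... | _ , rest , (_ , xrun , _) =
      blocks-start-in-field bls (proj₁ (xpow-ends (Block.k bl) (Block.k≠0 bl) xrun)) rest

    blocks-in-s : ∀ (bls : List (Block G)) {p c} → All (AdmissibleBlock maps (suc m′)) bls →
                  Old p → InField t c → Eval t (concatMap blockWord bls) p c →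
                  Eval s (concatMap blockWord bls) p c × Old c
    blocks-in-s []         []  old-p _  refl = refl , old-p
    blocks-in-s (bl ∷ bls) (((_ , g∈ , refl) , k≤) ∷ admissible) old-p c∈ run
      with Eval-++⁻ (blockWord bl) run
    ... | mid , rest , (c′ , xrun , refl) =
      let (mid∈ , c′∈)        = xpow-ends (Block.k bl) (Block.k≠0 bl) xrun
          (old-c′ , old-c)    = map-safe g∈ c′∈ c∈
          (rest-s , old-mid)  = blocks-in-s bls admissible old-p mid∈ rest
      in Eval-++⁺ (blockWord bl) rest-s (c′ , xpow-in-s (Block.k bl) old-mid old-c′ k≤ xrun , refl) ,
         old-c

    fix-in-s : ∀ w {a} → Admissible maps (suc m′) w → Fix t (toWord w) a → Fix s (toWord w) a
    fix-in-s (powX k 0<k) k≤ run = power-fix k 0<k k≤ run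
    fix-in-s (gWord bls _ _ _ (suc k₀) _) ((_ , g∈ , refl) , k₀≤ , admissible) run
      with Eval-++⁻ (concatMap blockWord bls) run
    ... | _ , (p₁ , xrun , refl) , rest =
      let (a∈ , p₁∈)      = x-run-ends k₀ xrun
          (old-p₁ , old-p) = map-safe g∈ (inj₂ p₁∈) (blocks-start-in-field bls (inj₁ a∈) rest)
          (rest-s , old-a) = blocks-in-s bls admissible old-p (inj₁ a∈) rest
      in Eval-++⁺ (concatMap blockWord bls)
                  (p₁ , xpow-in-s (+ suc k₀) old-a old-p₁ k₀≤ xrun , refl) rest-s

    t-below-s : ∀ E → All (Admissible maps (suc m′)) E → t , E ≤ℤ s , E
    t-below-s E admissible =
      s⊑t , (λ w∈ → w∈) ,
      λ {w} w∈ a → mk⇔ (fix-in-s w (All.lookup admissible w∈)) (Eval-mono s⊑t (toWord w))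

lemma4p7 : (G : CofinitaryGroup) (s : FPInj) (E : List (NiceWord G)) (n : ℕ) →
    ¬ InClosedOrbit s n →
    ∃ λ K → ∀ k → K < k →
      Σ FPInj λ t → (t , E ≤ℤ s , E) × Closed t n × HasCard (Orb t n) k
lemma4p7 G s E n n∉closed = length ps + maxExponent E , extend
  where
  O : OrbitPath s n
  O = orbitPath s n n∉closed
  open OrbitPath O using (ps)

  extend : ∀ k → length ps + maxExponent E < k →
           Σ FPInj λ t → (t , E ≤ℤ s , E) × Closed t n × HasCard (Orb t n) k
  extend k K<k with m≤n⇒∃[o]m+o≡n K<k
  ... | d , refl =
    t , t-below-s E (admissible E (m≤n⇒m≤1+n (m≤m+n _ d))) , t-closed ,
    subst (HasCard (Orb t n)) size orbit-card
    where
    open Extension s n O (allMaps E) (maxExponent E + d)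
    size : length ps + suc (maxExponent E + d) ≡ suc (length ps + maxExponent E + d)
    size = trans (+-suc (length ps) _) (cong suc (sym (+-assoc (length ps) (maxExponent E) d)))
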